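{- Let $n$ be a positive integer and $k$ a positive integer. The number of arithmetical structures $(\mathbf{d},\mathbf{r})$ on $\mathcal{P}_{n+2}$ with $\mathbf{r}(1)=2$ and $\mathbf{d}(1)=k$ is \[\binom{n-1}{2k-2}\,2^{\,n+1-2k}\,C_{k-1}.\]
   Context: $\mathcal{P}_N$ is the path graph with $N$ vertices $1,\dots,N$ and edges $\{j,j+1\}$, with adjacency matrix $A$. An arithmetical structure on $\mathcal{P}_N$ is a pair $(\mathbf{d},\mathbf{r})$ of positive integer vectors in $\mathbb{Z}^N$ with $\mathbf{r}$ primitive (gcd of entries $1$) and $(\operatorname{diag}(\mathbf{d})-A)\mathbf{r}=\mathbf{0}$. $\mathbf{r}(1)=\#\{j:r_j=1\}$ and $\mathbf{d}(1)=\#\{j: d_j=1\}$. $C_j=\frac{1}{j+1}\binom{2j}{j}$ is the Catalan number; $\binom{a}{b}=0$ if $b>a$. -}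

module Defs where

open import Data.Nat using (ℕ; zero; suc; _+_; _*_; _∸_; _^_; _<_; _/_)
open import Data.Nat.Properties using (_≟_)
open import Data.Nat.GCD using (gcd)
open import Data.Nat.Combinatorics using (_C_)
open import Data.Fin using (Fin; toℕ)
open import Data.List using (List; []; _∷_; length; filter; foldr)
open import Data.Vec using (Vec; lookup; toList)
open import Data.List.Relation.Unary.All using (All)
open import Relation.Binary.PropositionalEquality using (_≡_)

-- 0-based lookup into a list, returning 0 outside the range
-- (this encodes the boundary convention r_0 = r_{N+1} = 0 of the path).
getOr0 : List ℕ → ℕ → ℕ
getOr0 []       _       = 0
getOr0 (x ∷ xs) zero    = x
getOr0 (x ∷ xs) (suc i) = getOr0 xs i

leftNbr : {N : ℕ} → Vec ℕ N → ℕ → ℕ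
leftNbr r zero    = 0
leftNbr r (suc i) = getOr0 (toList r) i

rightNbr : {N : ℕ} → Vec ℕ N → ℕ → ℕ
rightNbr r i = getOr0 (toList r) (suc i)

gcdAll : {N : ℕ} → Vec ℕ N → ℕ
gcdAll r = foldr gcd 0 (toList r)

-- (diag(d) - A) r = 0 for the path graph P_N:
-- d_j r_j = r_{j-1} + r_{j+1} for every vertex j
PathEq : {N : ℕ} → Vec ℕ N → Vec ℕ N → Set
PathEq {N} d r = (j : Fin N) → lookup d j * lookup r j ≡ leftNbr r (toℕ j) + rightNbr r (toℕ j)

record IsArithStructure {N : ℕ} (d r : Vec ℕ N) : Set where
  field
    d-pos     : All (0 <_) (toList d)
    r-pos     : All (0 <_) (toList r)
    r-primitive : gcdAll r ≡ 1
    kernel    : PathEq d r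

-- number of entries equal to 1:  v(1) = #{ j : v_j = 1 }
ones : {N : ℕ} → Vec ℕ N → ℕ
ones v = length (filter (_≟ 1) (toList v))

catalan : ℕ → ℕ
catalan j = ((2 * j) C j) / suc j

-- An arithmetical structure on a path with r(1) = 2 has r = (1, r₂, …, r_(N-1), 1) with all
-- r_i ≥ 2 inside (r₁ and r_N divide every entry). For N ≥ 3 its d has an interior entry 1, and
-- smoothing that vertex away leaves such a structure on P_(N-1); conversely subdividing any edge
-- of a structure on P_N gives one on P_(N+1). So the structures on P_(N+2) are the iterated
-- subdivisions of ((1,1),(1,1)). The ones of d are isolated interior vertices, so if d(1) = k then
-- subdividing one of the N-1-2k edges away from them raises d(1) to k+1, subdividing one of the 2k
-- edges next to them keeps it, and in the result each of its ones can be smoothed back. Counting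
-- the pairs (structure, edge) both ways gives
--   k a(N+1, k) = (N+1-2k) a(N, k-1) + 2k a(N, k),
-- which the closed form satisfies by binomial absorption and (p+2) C_(p+1) = 2(2p+1) C_p.

module Submission where

open import Defs
open import Data.Nat
open import Data.Nat.Properties
open import Data.Nat.Combinatorics using (_C_; nCk+nC[k+1]≡[n+1]C[k+1]; k>n⇒nCk≡0)
open import Data.Nat.DivMod using (m*n/n≡m)
open import Data.Nat.Divisibility using (_∣_; ∣-refl; _∣0; ∣n⇒∣m*n; ∣m+n∣m⇒∣n; ∣1⇒≡1)
open import Data.Nat.GCD using (gcd; gcd-greatest; gcd-zeroˡ)
open import Data.Nat.ListAction using (sum)
open import Data.Nat.Tactic.RingSolver using (solve-∀)
open import Data.Fin using (Fin; toℕ; fromℕ<)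
open import Data.Fin.Properties using (toℕ<n; toℕ-fromℕ<)
open import Data.List using (List; []; _∷_; length; filter; map; _++_; concatMap; foldr; upTo; deduplicate)
open import Data.List.Properties using (filter-none; filter-some; length-++; length-map; length-upTo; map-upTo)
import Data.List.Properties as Listₚ
open import Data.List.Membership.Propositional using (_∈_; find; lose)
open import Data.List.Membership.Propositional.Properties
  using (∈-map⁺; ∈-map⁻; ∈-++⁺ˡ; ∈-++⁺ʳ; ∈-++⁻; ∈-filter⁺; ∈-filter⁻; ∈-upTo⁺; ∈-upTo⁻;
         ∈-concatMap⁺; ∈-concatMap⁻; ∈-deduplicate⁺; ∈-deduplicate⁻)
open import Data.List.Membership.Propositional.Properties.WithK using (unique∧set⇒bag)
open import Data.List.Membership.DecPropositional _≟_ using (_∈?_)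
open import Data.List.Relation.Binary.BagAndSetEquality using (∼bag⇒↭)
open import Data.List.Relation.Binary.Permutation.Propositional.Properties using (↭-length)
open import Data.List.Relation.Unary.All as All using (All; []; _∷_)
open import Data.List.Relation.Unary.All.Properties using (¬Any⇒All¬)
open import Data.List.Relation.Unary.Any as Any using (here; there)
open import Data.List.Relation.Unary.AllPairs using ([]; _∷_)
open import Data.List.Relation.Unary.Unique.Propositional using (Unique)
import Data.List.Relation.Unary.Unique.Propositional.Properties as Uniqueₚ
open import Data.List.Relation.Unary.Unique.DecPropositional.Properties using (deduplicate-!)
open import Data.Vec using (Vec; lookup; toList) renaming ([] to []ᵥ; _∷_ to _∷ᵥ_)
open import Data.Vec.Properties using (length-toList)
open import Data.Product using (Σ; ∃-syntax; _×_; _,_; proj₁; proj₂)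
import Data.Product.Properties as Productₚ
open import Data.Sum using (inj₁; inj₂)
open import Data.Unit using (⊤)
open import Data.Empty using (⊥; ⊥-elim)
open import Function using (_∘_)
open import Function.Bundles using (_⇔_; mk⇔; Equivalence)
open import Relation.Binary.Definitions using (DecidableEquality)
open import Relation.Binary.PropositionalEquality
open import Relation.Nullary using (¬_; Dec; yes; no; ¬?; contradiction)
open import Relation.Nullary.Decidable using (_×-dec_)
open import Relation.Unary using (Pred; Decidable)

⟦_⟧ : ∀ {p} {P : Set p} → Dec P → ℕ
⟦ yes _ ⟧ = 1
⟦ no  _ ⟧ = 0

module _ {A : Set} {p q} {P : Pred A p} {Q : Pred A q} (P? : Decidable P) (Q? : Decidable Q) where

  length-filter-≐-on : ∀ xs → (∀ {x} → x ∈ xs → P x → Q x) → (∀ {x} → x ∈ xs → Q x → P x) →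
                       length (filter P? xs) ≡ length (filter Q? xs)
  length-filter-≐-on []       _   _   = refl
  length-filter-≐-on (x ∷ xs) P⇒Q Q⇒P with P? x | Q? x
  ... | yes _  | yes _  = cong suc (length-filter-≐-on xs (P⇒Q ∘ there) (Q⇒P ∘ there))
  ... | yes px | no ¬qx = contradiction (P⇒Q (here refl) px) ¬qx
  ... | no ¬px | yes qx = contradiction (Q⇒P (here refl) qx) ¬px
  ... | no _   | no _   = length-filter-≐-on xs (P⇒Q ∘ there) (Q⇒P ∘ there)

length-filter-≗-on : ∀ {A : Set} (f g : A → ℕ) k xs → (∀ {x} → x ∈ xs → f x ≡ g x) →
                     length (filter (λ x → f x ≟ k) xs) ≡ length (filter (λ x → g x ≟ k) xs)
length-filter-≗-on f g k xs f≡g =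
  length-filter-≐-on _ _ xs (λ x∈ e → trans (sym (f≡g x∈)) e) (λ x∈ e → trans (f≡g x∈) e)

module _ {A : Set} {p} {P : Pred A p} (P? : Decidable P) where

  length-filter-∷ : ∀ x xs → length (filter P? (x ∷ xs)) ≡ ⟦ P? x ⟧ + length (filter P? xs)
  length-filter-∷ x xs with P? x
  ... | yes _ = refl
  ... | no  _ = refl

  length-filter-+-complement : ∀ xs → length (filter P? xs) + length (filter (¬? ∘ P?) xs) ≡ length xs
  length-filter-+-complement []       = refl
  length-filter-+-complement (x ∷ xs) with P? x
  ... | yes _ = cong suc (length-filter-+-complement xs)
  ... | no  _ = trans (+-suc _ _) (cong suc (length-filter-+-complement xs))

  length-filter-map : ∀ {B : Set} (f : B → A) xs → length (filter P? (map f xs)) ≡ length (filter (P? ∘ f) xs)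
  length-filter-map f []       = refl
  length-filter-map f (x ∷ xs) with P? (f x)
  ... | yes _ = cong suc (length-filter-map f xs)
  ... | no  _ = length-filter-map f xs

length-filter-upTo-suc : ∀ {p} {P : Pred ℕ p} (P? : Decidable P) n →
  length (filter P? (upTo (suc n))) ≡ ⟦ P? 0 ⟧ + length (filter (P? ∘ suc) (upTo n))
length-filter-upTo-suc P? n = trans (length-filter-∷ P? 0 _)
  (cong (⟦ P? 0 ⟧ +_) (trans (cong (length ∘ filter P?) (sym (map-upTo suc n))) (length-filter-map P? suc (upTo n))))

Unique-map-on : ∀ {A B : Set} (f : A → B) {xs : List A} → Unique xs →
                (∀ {x y} → x ∈ xs → y ∈ xs → f x ≡ f y → x ≡ y) → Unique (map f xs)
Unique-map-on f {[]}     []         _   = []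
Unique-map-on f {x ∷ xs} (x∉ ∷ uxs) inj =
  All.tabulate fx∉ ∷ Unique-map-on f uxs (λ a b → inj (there a) (there b))
  where
  fx∉ : ∀ {w} → w ∈ map f xs → f x ≢ w
  fx∉ w∈ fx≡w with ∈-map⁻ f w∈
  ... | y , y∈ , refl = All.lookup x∉ y∈ (inj (here refl) (there y∈) fx≡w)

length-≡-inverse-on : ∀ {A B : Set} {xs : List A} {ys : List B} → Unique xs → Unique ys →
  (f : A → B) (g : B → A) → (∀ {x} → x ∈ xs → f x ∈ ys) → (∀ {y} → y ∈ ys → g y ∈ xs) →
  (∀ {x} → x ∈ xs → g (f x) ≡ x) → (∀ {y} → y ∈ ys → f (g y) ≡ y) →
  length xs ≡ length ys
length-≡-inverse-on {xs = xs} {ys} uxs uys f g f∈ g∈ gf fg =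
  trans (sym (length-map f xs))
        (↭-length (∼bag⇒↭ (unique∧set⇒bag (Unique-map-on f uxs injective) uys (mk⇔ to from))))
  where
  injective : ∀ {x y} → x ∈ xs → y ∈ xs → f x ≡ f y → x ≡ y
  injective x∈ y∈ eq = trans (sym (gf x∈)) (trans (cong g eq) (gf y∈))
  to : ∀ {y} → y ∈ map f xs → y ∈ ys
  to y∈ with ∈-map⁻ f y∈
  ... | _ , x∈ , refl = f∈ x∈
  from : ∀ {y} → y ∈ ys → y ∈ map f xs
  from y∈ = subst (_∈ map f xs) (fg y∈) (∈-map⁺ f (g∈ y∈))

pairsWith : ∀ {A B : Set} → (A → List B) → List A → List (A × B)
pairsWith h []       = []
pairsWith h (x ∷ xs) = map (x ,_) (h x) ++ pairsWith h xs

module _ {A B : Set} (h : A → List B) where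

  ∈-pairsWith⁻ : ∀ xs {x y} → (x , y) ∈ pairsWith h xs → x ∈ xs × y ∈ h x
  ∈-pairsWith⁻ (z ∷ xs) p with ∈-++⁻ (map (z ,_) (h z)) p
  ... | inj₁ q with ∈-map⁻ (z ,_) q
  ...   | _ , y∈ , refl = here refl , y∈
  ∈-pairsWith⁻ (z ∷ xs) p | inj₂ q with ∈-pairsWith⁻ xs q
  ...   | x∈ , y∈ = there x∈ , y∈

  ∈-pairsWith⁺ : ∀ xs {x y} → x ∈ xs → y ∈ h x → (x , y) ∈ pairsWith h xs
  ∈-pairsWith⁺ (z ∷ xs) (here refl) y∈ = ∈-++⁺ˡ (∈-map⁺ (z ,_) y∈)
  ∈-pairsWith⁺ (z ∷ xs) (there x∈) y∈ = ∈-++⁺ʳ (map (z ,_) (h z)) (∈-pairsWith⁺ xs x∈ y∈)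

  Unique-pairsWith : ∀ {xs} → Unique xs → (∀ x → Unique (h x)) → Unique (pairsWith h xs)
  Unique-pairsWith {[]}     _          _  = []
  Unique-pairsWith {x ∷ xs} (x∉ ∷ uxs) uh =
    Uniqueₚ.++⁺ (Uniqueₚ.map⁺ (λ { refl → refl }) (uh x)) (Unique-pairsWith uxs uh) disjoint
    where
    disjoint : ∀ {v} → ¬ (v ∈ map (x ,_) (h x) × v ∈ pairsWith h xs)
    disjoint (p , q) with ∈-map⁻ (x ,_) p
    ... | _ , _ , refl = All.lookup x∉ (proj₁ (∈-pairsWith⁻ xs q)) refl

  length-pairsWith : ∀ xs → length (pairsWith h xs) ≡ sum (map (length ∘ h) xs)
  length-pairsWith []       = refl
  length-pairsWith (x ∷ xs) =
    trans (length-++ (map (x ,_) (h x))) (cong₂ _+_ (length-map (x ,_) (h x)) (length-pairsWith xs))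

module _ {A : Set} where

  sum-map-cong-on : ∀ (f g : A → ℕ) xs → (∀ {x} → x ∈ xs → f x ≡ g x) → sum (map f xs) ≡ sum (map g xs)
  sum-map-cong-on f g []       _   = refl
  sum-map-cong-on f g (x ∷ xs) f≡g = cong₂ _+_ (f≡g (here refl)) (sum-map-cong-on f g xs (f≡g ∘ there))

  sum-map-const-on : ∀ (f : A → ℕ) c xs → (∀ {x} → x ∈ xs → f x ≡ c) → sum (map f xs) ≡ c * length xs
  sum-map-const-on f c []       _    = sym (*-zeroʳ c)
  sum-map-const-on f c (x ∷ xs) f≡c =
    trans (cong₂ _+_ (f≡c (here refl)) (sum-map-const-on f c xs (f≡c ∘ there))) (sym (*-suc c (length xs)))

⟦⟧*-cong : ∀ {p} {P : Set p} (P? : Dec P) {a b} → (P → a ≡ b) → ⟦ P? ⟧ * a ≡ ⟦ P? ⟧ * b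
⟦⟧*-cong (yes p) a≡b = cong (1 *_) (a≡b p)
⟦⟧*-cong (no  _) _   = refl

module _ {A : Set} {p q} {P : Pred A p} {Q : Pred A q} (P? : Decidable P) (Q? : Decidable Q) where

  sum-map-⟦⟧*+⟦⟧* : ∀ a b xs → sum (map (λ x → ⟦ P? x ⟧ * a + ⟦ Q? x ⟧ * b) xs)
                               ≡ a * length (filter P? xs) + b * length (filter Q? xs)
  sum-map-⟦⟧*+⟦⟧* a b []       = sym (cong₂ _+_ (*-zeroʳ a) (*-zeroʳ b))
  sum-map-⟦⟧*+⟦⟧* a b (x ∷ xs) = begin
    ⟦ P? x ⟧ * a + ⟦ Q? x ⟧ * b + sum (map (λ x → ⟦ P? x ⟧ * a + ⟦ Q? x ⟧ * b) xs)
      ≡⟨ cong (⟦ P? x ⟧ * a + ⟦ Q? x ⟧ * b +_) (sum-map-⟦⟧*+⟦⟧* a b xs) ⟩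
    ⟦ P? x ⟧ * a + ⟦ Q? x ⟧ * b + (a * length (filter P? xs) + b * length (filter Q? xs))
      ≡⟨ distribute ⟦ P? x ⟧ ⟦ Q? x ⟧ a b (length (filter P? xs)) (length (filter Q? xs)) ⟩
    a * (⟦ P? x ⟧ + length (filter P? xs)) + b * (⟦ Q? x ⟧ + length (filter Q? xs))
      ≡⟨ sym (cong₂ (λ u v → a * u + b * v) (length-filter-∷ P? x xs) (length-filter-∷ Q? x xs)) ⟩
    a * length (filter P? (x ∷ xs)) + b * length (filter Q? (x ∷ xs)) ∎
    where
    open ≡-Reasoning
    distribute : ∀ u v a b s t → u * a + v * b + (a * s + b * t) ≡ a * (u + s) + b * (v + t)
    distribute = solve-∀

module _ {A : Set} {q} {Q : Pred A q} (Q? : Decidable Q) where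

  length-filter-⟦⟧+o≡1+m : ∀ xs o m →
    length (filter (λ x → ⟦ Q? x ⟧ + o ≟ suc m) xs)
      ≡ ⟦ o ≟ m ⟧ * length (filter Q? xs) + ⟦ o ≟ suc m ⟧ * length (filter (¬? ∘ Q?) xs)
  length-filter-⟦⟧+o≡1+m xs o m with o ≟ m | o ≟ suc m
  ... | yes refl | yes o≡1+o = contradiction o≡1+o (<⇒≢ (n<1+n o))
  ... | yes refl | no  _     =
    trans (length-filter-≐-on _ Q? xs (λ _ → raised) (λ _ → raise)) (sym (trans (+-identityʳ _) (+-identityʳ _)))
    where
    raised : ∀ {x} → ⟦ Q? x ⟧ + o ≡ suc o → Q x
    raised {x} e with Q? x
    ... | yes qx = qx
    ... | no  _  = contradiction e (<⇒≢ (n<1+n o))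
    raise : ∀ {x} → Q x → ⟦ Q? x ⟧ + o ≡ suc o
    raise {x} qx with Q? x
    ... | yes _   = refl
    ... | no  ¬qx = contradiction qx ¬qx
  ... | no  _    | yes refl  =
    trans (length-filter-≐-on _ (¬? ∘ Q?) xs (λ _ → kept) (λ _ → keep)) (sym (+-identityʳ _))
    where
    kept : ∀ {x} → ⟦ Q? x ⟧ + suc m ≡ suc m → ¬ Q x
    kept {x} e with Q? x
    ... | yes _ = contradiction (sym e) (<⇒≢ (n<1+n (suc m)))
    ... | no ¬qx = ¬qx
    keep : ∀ {x} → ¬ Q x → ⟦ Q? x ⟧ + suc m ≡ suc m
    keep {x} ¬qx with Q? x
    ... | yes qx = contradiction qx ¬qx
    ... | no  _  = refl
  ... | no  o≢m  | no  o≢1+m =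
    cong length (filter-none (λ x → ⟦ Q? x ⟧ + o ≟ suc m) {xs} (All.tabulate (λ {x} _ → never x)))
    where
    never : ∀ x → ⟦ Q? x ⟧ + o ≢ suc m
    never x e with Q? x
    ... | yes _ = o≢m (suc-injective e)
    ... | no  _ = o≢1+m e

choose : ℕ → ℕ → ℕ
choose n       zero    = 1
choose zero    (suc k) = 0
choose (suc n) (suc k) = choose n k + choose n (suc k)

choose≡C : ∀ n k → choose n k ≡ n C k
choose≡C n       zero    = refl
choose≡C zero    (suc k) = sym (k>n⇒nCk≡0 {0} {suc k} (s≤s z≤n))
choose≡C (suc n) (suc k) =
  trans (cong₂ _+_ (choose≡C n k) (choose≡C n (suc k))) (nCk+nC[k+1]≡[n+1]C[k+1] n k)

choose[n,1]≡n : ∀ n → choose n 1 ≡ n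
choose[n,1]≡n zero    = refl
choose[n,1]≡n (suc n) = cong suc (choose[n,1]≡n n)

k>n⇒choose≡0 : ∀ {n k} → n < k → choose n k ≡ 0
k>n⇒choose≡0 {zero}  {suc k} _         = refl
k>n⇒choose≡0 {suc n} {suc k} (s≤s n<k) = cong₂ _+_ (k>n⇒choose≡0 n<k) (k>n⇒choose≡0 (m<n⇒m<1+n n<k))

choose-absorption : ∀ a j → choose a (suc j) * suc j + choose a j * j ≡ choose a j * a
choose-absorption zero    zero    = refl
choose-absorption zero    (suc j) = refl
choose-absorption (suc a) zero =
  trans (cong (λ c → c * 1 + 1 * 0) (choose[n,1]≡n (suc a))) (unit (suc a))
  where
  unit : ∀ a → a * 1 + 1 * 0 ≡ 1 * a
  unit = solve-∀
choose-absorption (suc a) (suc j) = begin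
  (y + z) * (2 + j) + (x + y) * (1 + j)
    ≡⟨ regroup x y z j ⟩
  (z * (2 + j) + y * (1 + j)) + (y * (1 + j) + x * j) + (x + y)
    ≡⟨ cong₂ (λ u v → u + v + (x + y)) (choose-absorption a (suc j)) (choose-absorption a j) ⟩
  y * a + x * a + (x + y)
    ≡⟨ collect x y a ⟩
  (x + y) * (1 + a) ∎
  where
  open ≡-Reasoning
  x = choose a j
  y = choose a (suc j)
  z = choose a (suc (suc j))
  regroup : ∀ x y z j → (y + z) * (2 + j) + (x + y) * (1 + j)
                      ≡ (z * (2 + j) + y * (1 + j)) + (y * (1 + j) + x * j) + (x + y)
  regroup = solve-∀
  collect : ∀ x y a → y * a + x * a + (x + y) ≡ (x + y) * (1 + a)
  collect = solve-∀

choose-ratio : ∀ {a} j {i} → j + i ≡ a → choose a (suc j) * suc j ≡ choose a j * i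
choose-ratio {a} j {i} refl = +-cancelʳ-≡ (x * j) (choose a (suc j) * suc j) (x * i) (begin
  choose a (suc j) * suc j + x * j ≡⟨ choose-absorption a j ⟩
  x * (j + i)                      ≡⟨ *-distribˡ-+ x j i ⟩
  x * j + x * i                    ≡⟨ +-comm (x * j) (x * i) ⟩
  x * i + x * j                    ∎)
  where
  open ≡-Reasoning
  x = choose a j

m+m≡2*m : ∀ m → m + m ≡ 2 * m
m+m≡2*m m = cong (m +_) (sym (+-identityʳ m))

2*[1+m]≡2+2*m : ∀ m → 2 * suc m ≡ 2 + 2 * m
2*[1+m]≡2+2*m = solve-∀

[1+m]*catalan≡central : ∀ m → suc m * catalan m ≡ choose (2 * m) m
[1+m]*catalan≡central m = begin
  suc m * catalan m ≡⟨ cong (suc m *_) catalan≡x∸y ⟩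
  suc m * (x ∸ y)   ≡⟨ *-comm (suc m) (x ∸ y) ⟩
  (x ∸ y) * suc m   ≡⟨ [x∸y]*[1+m]≡x ⟩
  x                 ∎
  where
  open ≡-Reasoning
  x = choose (2 * m) m
  y = choose (2 * m) (suc m)
  [x∸y]*[1+m]≡x : (x ∸ y) * suc m ≡ x
  [x∸y]*[1+m]≡x = begin
    (x ∸ y) * suc m       ≡⟨ *-distribʳ-∸ (suc m) x y ⟩
    x * suc m ∸ y * suc m ≡⟨ cong₂ _∸_ (*-suc x m) (choose-ratio m (m+m≡2*m m)) ⟩
    x + x * m ∸ x * m     ≡⟨ m+n∸n≡m x (x * m) ⟩
    x                     ∎
  catalan≡x∸y : catalan m ≡ x ∸ y
  catalan≡x∸y = begin
    ((2 * m) C m) / suc m   ≡⟨ cong (_/ suc m) (sym (choose≡C (2 * m) m)) ⟩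
    x / suc m               ≡⟨ cong (_/ suc m) (sym [x∸y]*[1+m]≡x) ⟩
    (x ∸ y) * suc m / suc m ≡⟨ m*n/n≡m (x ∸ y) (suc m) ⟩
    x ∸ y                   ∎

catalan-suc : ∀ p → (2 + p) * catalan (suc p) ≡ 2 * (1 + 2 * p) * catalan p
catalan-suc p = *-cancelˡ-≡ _ _ (suc p) (begin
  suc p * ((2 + p) * catalan (suc p))   ≡⟨ cong (suc p *_) ([1+m]*catalan≡central (suc p)) ⟩
  suc p * choose (2 * suc p) (suc p)    ≡⟨ cong (λ a → suc p * choose a (suc p)) (2*[1+m]≡2+2*m p) ⟩
  suc p * (y₁ + (x + z))                ≡⟨ cong (λ w → suc p * (w + (x + z))) y₁≡x+z ⟩
  suc p * ((x + z) + (x + z))           ≡⟨ regroup p x z ⟩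
  2 * (x * suc p + z * suc p)           ≡⟨ cong (λ w → 2 * (x * suc p + w)) (choose-ratio p (m+m≡2*m p)) ⟩
  2 * (x * suc p + x * p)               ≡⟨ cong (λ w → 2 * (w * suc p + w * p)) (sym ([1+m]*catalan≡central p)) ⟩
  2 * (suc p * c * suc p + suc p * c * p) ≡⟨ collect p c ⟩
  suc p * (2 * (1 + 2 * p) * c)         ∎)
  where
  open ≡-Reasoning
  x = choose (2 * p) p
  z = choose (2 * p) (suc p)
  y₁ = choose (suc (2 * p)) p
  c = catalan p
  y₁≡x+z : y₁ ≡ x + z
  y₁≡x+z = sym (*-cancelʳ-≡ _ _ (suc p) (choose-ratio p (trans (+-suc p p) (cong suc (m+m≡2*m p)))))
  regroup : ∀ p x z → suc p * ((x + z) + (x + z)) ≡ 2 * (x * suc p + z * suc p)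
  regroup = solve-∀
  collect : ∀ p c → 2 * (suc p * c * suc p + suc p * c * p) ≡ suc p * (2 * (1 + 2 * p) * c)
  collect = solve-∀

-- The formula of the statement for P_(n+3) and d(1) = k (with the value 0 at k = 0).
closedForm : ℕ → ℕ → ℕ
closedForm n zero    = 0
closedForm n (suc m) = choose n (2 * m) * 2 ^ (n ∸ 2 * m) * catalan m

ClosedFormRecurrence : ℕ → ℕ → Set
ClosedFormRecurrence n m =
  suc m * closedForm (suc n) (suc m) ≡ (2 + n ∸ 2 * m) * closedForm n m + 2 * suc m * closedForm n (suc m)

2*2^pred≡2^ : ∀ t x → (t ≡ 0 → x ≡ 0) → 2 * 2 ^ pred t * x ≡ 2 ^ t * x
2*2^pred≡2^ zero    x x≡0 rewrite x≡0 refl = refl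
2*2^pred≡2^ (suc t) x _                    = refl

recurrence-algebra : ∀ p t x₁ x₂ y u v c₀ c₁ →
  (2 + p) * c₁ ≡ 2 * (1 + 2 * p) * c₀ → x₁ * (1 + 2 * p) ≡ y * (1 + t) → 2 * v * x₂ ≡ u * x₂ →
  (2 + p) * ((x₁ + x₂) * u * c₁) ≡ (1 + t) * (y * (2 * u) * c₀) + 2 * (2 + p) * (x₂ * v * c₁)
recurrence-algebra p t x₁ x₂ y u v c₀ c₁ hc hx hv = begin
  (2 + p) * ((x₁ + x₂) * u * c₁)
    ≡⟨ distribute p x₁ x₂ u c₁ ⟩
  u * x₁ * ((2 + p) * c₁) + (2 + p) * c₁ * (u * x₂)
    ≡⟨ cong₂ (λ a b → u * x₁ * a + (2 + p) * c₁ * b) hc (sym hv) ⟩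
  u * x₁ * (2 * (1 + 2 * p) * c₀) + w
    ≡⟨ cong (_+ w) (regroup u x₁ p c₀) ⟩
  2 * u * c₀ * (x₁ * (1 + 2 * p)) + w
    ≡⟨ cong (λ a → 2 * u * c₀ * a + w) hx ⟩
  2 * u * c₀ * (y * (1 + t)) + w
    ≡⟨ collect p t y u v c₀ c₁ x₂ ⟩
  (1 + t) * (y * (2 * u) * c₀) + 2 * (2 + p) * (x₂ * v * c₁) ∎
  where
  open ≡-Reasoning
  w = (2 + p) * c₁ * (2 * v * x₂)
  distribute : ∀ p x₁ x₂ u c₁ →
    (2 + p) * ((x₁ + x₂) * u * c₁) ≡ u * x₁ * ((2 + p) * c₁) + (2 + p) * c₁ * (u * x₂)
  distribute = solve-∀
  regroup : ∀ u x₁ p c₀ → u * x₁ * (2 * (1 + 2 * p) * c₀) ≡ 2 * u * c₀ * (x₁ * (1 + 2 * p))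
  regroup = solve-∀
  collect : ∀ p t y u v c₀ c₁ x₂ →
    2 * u * c₀ * (y * (1 + t)) + (2 + p) * c₁ * (2 * v * x₂)
      ≡ (1 + t) * (y * (2 * u) * c₀) + 2 * (2 + p) * (x₂ * v * c₁)
  collect = solve-∀

closedForm-recurrence-2p<n : ∀ p t → ClosedFormRecurrence (suc (2 * p + t)) (suc p)
closedForm-recurrence-2p<n p t = begin
  suc (suc p) * closedForm (suc n) (suc (suc p))
    ≡⟨ cong (suc (suc p) *_) left-form ⟩
  (2 + p) * ((x₁ + x₂) * 2 ^ t * c₁)
    ≡⟨ recurrence-algebra p t x₁ x₂ y (2 ^ t) (2 ^ pred t) c₀ c₁ (catalan-suc p) ratio halve ⟩
  suc t * (y * 2 ^ suc t * c₀) + 2 * (2 + p) * (x₂ * 2 ^ pred t * c₁)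
    ≡⟨ sym (cong₂ (λ a b → a + 2 * (2 + p) * b) (cong₂ _*_ n∸2p≡1+t middle-form) right-form) ⟩
  (n ∸ 2 * p) * closedForm n (suc p) + 2 * (2 + p) * closedForm n (suc (suc p))
    ≡⟨ cong (λ a → (2 + n ∸ a) * closedForm n (suc p) + 2 * (2 + p) * closedForm n (suc (suc p)))
            (sym (2*[1+m]≡2+2*m p)) ⟩
  (2 + n ∸ 2 * suc p) * closedForm n (suc p) + 2 * (2 + p) * closedForm n (suc (suc p)) ∎
  where
  open ≡-Reasoning
  n = suc (2 * p + t)
  x₁ = choose n (suc (2 * p))
  x₂ = choose n (2 + 2 * p)
  y = choose n (2 * p)
  c₀ = catalan p
  c₁ = catalan (suc p)
  n∸2p≡1+t : n ∸ 2 * p ≡ suc t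
  n∸2p≡1+t = trans (cong (_∸ 2 * p) (sym (+-suc (2 * p) t))) (m+n∸m≡n (2 * p) (suc t))
  left-form : closedForm (suc n) (suc (suc p)) ≡ (x₁ + x₂) * 2 ^ t * c₁
  left-form = cong₂ (λ a b → choose (suc n) a * 2 ^ b * c₁) (2*[1+m]≡2+2*m p)
                    (trans (cong (suc n ∸_) (2*[1+m]≡2+2*m p)) (m+n∸m≡n (2 * p) t))
  middle-form : closedForm n (suc p) ≡ y * 2 ^ suc t * c₀
  middle-form = cong (λ b → y * 2 ^ b * c₀) n∸2p≡1+t
  right-form : closedForm n (suc (suc p)) ≡ x₂ * 2 ^ pred t * c₁
  right-form = cong₂ (λ a b → choose n a * 2 ^ b * c₁) (2*[1+m]≡2+2*m p)
                     (trans (cong (n ∸_) (2*[1+m]≡2+2*m p))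
                       (trans (sym (pred[m∸n]≡m∸[1+n] (2 * p + t) (2 * p))) (cong pred (m+n∸m≡n (2 * p) t))))
  ratio : x₁ * (1 + 2 * p) ≡ y * (1 + t)
  ratio = choose-ratio (2 * p) (+-suc (2 * p) t)
  halve : 2 * 2 ^ pred t * x₂ ≡ 2 ^ t * x₂
  halve = 2*2^pred≡2^ t x₂ λ { refl → k>n⇒choose≡0 (s≤s (s≤s (≤-reflexive (+-identityʳ (2 * p))))) }

closedForm-recurrence : ∀ n m → ClosedFormRecurrence n m
closedForm-recurrence n zero = first (2 + n) (2 ^ n)
  where
  first : ∀ a w → 1 * (1 * (2 * w) * 1) ≡ a * 0 + 2 * 1 * (1 * w * 1)
  first = solve-∀
closedForm-recurrence n (suc p) with n ≤? 2 * p
... | no  2p≱n = subst (λ n → ClosedFormRecurrence n (suc p)) (m+[n∸m]≡n (≰⇒> 2p≱n))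
                       (closedForm-recurrence-2p<n p (n ∸ suc (2 * p)))
... | yes n≤2p
  rewrite k>n⇒choose≡0 {suc n} {2 * suc p} (subst (suc n <_) (sym (2*[1+m]≡2+2*m p)) (s≤s (s≤s n≤2p)))
        | k>n⇒choose≡0 {n} {2 * suc p} (subst (n <_) (sym (2*[1+m]≡2+2*m p)) (s≤s (m≤n⇒m≤1+n n≤2p)))
        | m≤n⇒m∸n≡0 (subst (2 + n ≤_) (sym (2*[1+m]≡2+2*m p)) (s≤s (s≤s n≤2p)))
  = trans (*-zeroʳ (suc (suc p))) (sym (*-zeroʳ (2 * suc (suc p))))

ones′ : List ℕ → ℕ
ones′ xs = length (filter (_≟ 1) xs)

isOne : ℕ → ℕ
isOne x = ⟦ x ≟ 1 ⟧

isOne-≢1 : ∀ {x} → x ≢ 1 → isOne x ≡ 0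
isOne-≢1 {x} x≢1 with x ≟ 1
... | yes x≡1 = contradiction x≡1 x≢1
... | no  _   = refl

ones′-∷ : ∀ x xs → ones′ (x ∷ xs) ≡ isOne x + ones′ xs
ones′-∷ = length-filter-∷ (_≟ 1)

-- d_i r_i = r_(i-1) + r_(i+1) along the lists, with l standing left of r and 0 right of it.
InKernel : ℕ → List ℕ → List ℕ → Set
InKernel l []       []       = ⊤
InKernel l (d ∷ ds) (x ∷ xs) = d * x ≡ l + getOr0 xs 0 × InKernel x ds xs
InKernel l _        _        = ⊥

InKernel-length : ∀ {l} ds rs → InKernel l ds rs → length ds ≡ length rs
InKernel-length []       []       _       = refl
InKernel-length (d ∷ ds) (x ∷ xs) (_ , k) = cong suc (InKernel-length ds xs k)

positive-factor : ∀ d x s → d * x ≡ s → 0 < s → 0 < d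
positive-factor zero    x s eq s>0 = contradiction (sym eq) (>⇒≢ s>0)
positive-factor (suc d) x s _  _   = z<s

InKernel⇒d-pos : ∀ {l} ds rs → InKernel l ds rs → All (0 <_) rs → 0 < l + getOr0 rs 1 → All (0 <_) ds
InKernel⇒d-pos []       []       _       _          _ = []
InKernel⇒d-pos (d ∷ ds) (x ∷ xs) (e , k) (x>0 ∷ xs>0) h =
  positive-factor d x _ e h ∷ InKernel⇒d-pos ds xs k xs>0 (≤-trans x>0 (m≤m+n x _))

-- Subdividing the edge between the (0-based) positions j and j+1 inserts a vertex with d = 1 and
-- r = r_j + r_(j+1); smoothing undoes this at position j+1. Out of range, both leave the lists alone.
subdivideᵈ : ℕ → List ℕ → List ℕ
subdivideᵈ zero    (a ∷ b ∷ ds) = suc a ∷ 1 ∷ suc b ∷ ds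
subdivideᵈ (suc j) (a ∷ ds)     = a ∷ subdivideᵈ j ds
subdivideᵈ _       ds           = ds

subdivideʳ : ℕ → List ℕ → List ℕ
subdivideʳ zero    (x ∷ y ∷ rs) = x ∷ x + y ∷ y ∷ rs
subdivideʳ (suc j) (x ∷ rs)     = x ∷ subdivideʳ j rs
subdivideʳ _       rs           = rs

smoothᵈ : ℕ → List ℕ → List ℕ
smoothᵈ zero    (a ∷ _ ∷ b ∷ ds) = pred a ∷ pred b ∷ ds
smoothᵈ (suc j) (a ∷ ds)         = a ∷ smoothᵈ j ds
smoothᵈ _       ds               = ds

smoothʳ : ℕ → List ℕ → List ℕ
smoothʳ zero    (x ∷ _ ∷ y ∷ rs) = x ∷ y ∷ rs
smoothʳ (suc j) (x ∷ rs)         = x ∷ smoothʳ j rs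
smoothʳ _       rs               = rs

DR : Set
DR = List ℕ × List ℕ

subdivide : ℕ → DR → DR
subdivide j (ds , rs) = subdivideᵈ j ds , subdivideʳ j rs

smooth : ℕ → DR → DR
smooth j (ds , rs) = smoothᵈ j ds , smoothʳ j rs

smoothᵈ-subdivideᵈ : ∀ j ds → smoothᵈ j (subdivideᵈ j ds) ≡ ds
smoothᵈ-subdivideᵈ zero    []           = refl
smoothᵈ-subdivideᵈ zero    (a ∷ [])     = refl
smoothᵈ-subdivideᵈ zero    (a ∷ b ∷ ds) = refl
smoothᵈ-subdivideᵈ (suc j) []           = refl
smoothᵈ-subdivideᵈ (suc j) (a ∷ ds)     = cong (a ∷_) (smoothᵈ-subdivideᵈ j ds)

smoothʳ-subdivideʳ : ∀ j rs → smoothʳ j (subdivideʳ j rs) ≡ rs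
smoothʳ-subdivideʳ zero    []           = refl
smoothʳ-subdivideʳ zero    (x ∷ [])     = refl
smoothʳ-subdivideʳ zero    (x ∷ y ∷ rs) = refl
smoothʳ-subdivideʳ (suc j) []           = refl
smoothʳ-subdivideʳ (suc j) (x ∷ rs)     = cong (x ∷_) (smoothʳ-subdivideʳ j rs)

smooth-subdivide : ∀ j S → smooth j (subdivide j S) ≡ S
smooth-subdivide j (ds , rs) = cong₂ _,_ (smoothᵈ-subdivideᵈ j ds) (smoothʳ-subdivideʳ j rs)

length-subdivideᵈ : ∀ j ds → suc j < length ds → length (subdivideᵈ j ds) ≡ suc (length ds)
length-subdivideᵈ zero    (a ∷ b ∷ ds) _         = refl
length-subdivideᵈ (suc j) (a ∷ ds)     (s≤s lt) = cong suc (length-subdivideᵈ j ds lt)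
length-subdivideᵈ zero    (a ∷ [])     (s≤s ())

length-smoothᵈ : ∀ j ds → suc (suc j) < length ds → suc (length (smoothᵈ j ds)) ≡ length ds
length-smoothᵈ zero    (a ∷ b ∷ c ∷ ds) _         = refl
length-smoothᵈ (suc j) (a ∷ ds)         (s≤s lt) = cong suc (length-smoothᵈ j ds lt)
length-smoothᵈ zero    (a ∷ [])         (s≤s ())
length-smoothᵈ zero    (a ∷ b ∷ [])     (s≤s (s≤s ()))

head-subdivideʳ : ∀ j rs → getOr0 (subdivideʳ j rs) 0 ≡ getOr0 rs 0
head-subdivideʳ zero    []           = refl
head-subdivideʳ zero    (x ∷ [])     = refl
head-subdivideʳ zero    (x ∷ y ∷ rs) = refl
head-subdivideʳ (suc j) []           = refl
head-subdivideʳ (suc j) (x ∷ rs)     = refl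

InKernel-subdivide : ∀ l j ds rs → suc j < length ds →
                     InKernel l (subdivideᵈ j ds) (subdivideʳ j rs) ⇔ InKernel l ds rs
InKernel-subdivide l zero (a ∷ b ∷ ds) (x ∷ y ∷ rs) _ = mk⇔
  (λ { (e₁ , _ , e₂ , k) → Equivalence.to (left l x y a) e₁ , Equivalence.to (right x y b (getOr0 rs 0)) e₂ , k })
  (λ { (e₁ , e₂ , k) → Equivalence.from (left l x y a) e₁ , +-identityʳ (x + y)
                      , Equivalence.from (right x y b (getOr0 rs 0)) e₂ , k })
  where
  left : ∀ l x y a → suc a * x ≡ l + (x + y) ⇔ a * x ≡ l + y
  left l x y a = mk⇔ (λ e → +-cancelˡ-≡ x _ _ (trans e (swap l x y)))
                     (λ e → trans (cong (x +_) e) (sym (swap l x y)))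
    where
    swap : ∀ l x y → l + (x + y) ≡ x + (l + y)
    swap = solve-∀
  right : ∀ x y b h → suc b * y ≡ x + y + h ⇔ b * y ≡ x + h
  right x y b h = mk⇔ (λ e → +-cancelˡ-≡ y _ _ (trans e (swap x y h)))
                      (λ e → trans (cong (y +_) e) (sym (swap x y h)))
    where
    swap : ∀ x y h → x + y + h ≡ y + (x + h)
    swap = solve-∀
InKernel-subdivide l zero    (a ∷ b ∷ ds) (x ∷ [])    _ = mk⇔ (λ { (_ , ()) }) (λ { (_ , ()) })
InKernel-subdivide l zero    (a ∷ b ∷ ds) []          _ = mk⇔ (λ ()) (λ ())
InKernel-subdivide l (suc j) (a ∷ ds)     (x ∷ rs) (s≤s lt) = mk⇔
  (λ { (e , k) → trans e (cong (l +_) (head-subdivideʳ j rs)) , Equivalence.to (InKernel-subdivide x j ds rs lt) k })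
  (λ { (e , k) → trans e (cong (l +_) (sym (head-subdivideʳ j rs))) , Equivalence.from (InKernel-subdivide x j ds rs lt) k })
InKernel-subdivide l (suc j) (a ∷ ds)     []       _        = mk⇔ (λ ()) (λ ())
InKernel-subdivide l zero    (a ∷ [])     _        (s≤s ())

data OnlyLastIsOne : List ℕ → Set where
  [1] : OnlyLastIsOne (1 ∷ [])
  _∷_ : ∀ {x xs} → 2 ≤ x → OnlyLastIsOne xs → OnlyLastIsOne (x ∷ xs)

-- r = (1, r₂, …, r_(N-1), 1) with r_i ≥ 2 inside: the primitive r of a path with r(1) = 2.
data RShape : List ℕ → Set where
  1∷_ : ∀ {t} → OnlyLastIsOne t → RShape (1 ∷ t)

OnlyLastIsOne⇒pos : ∀ {t} → OnlyLastIsOne t → All (0 <_) t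
OnlyLastIsOne⇒pos [1]         = z<s ∷ []
OnlyLastIsOne⇒pos (x≥2 ∷ rest) = ≤-trans z<s x≥2 ∷ OnlyLastIsOne⇒pos rest

OnlyLastIsOne-head-pos : ∀ {t} → OnlyLastIsOne t → 0 < getOr0 t 0
OnlyLastIsOne-head-pos [1]       = z<s
OnlyLastIsOne-head-pos (x≥2 ∷ _) = ≤-trans z<s x≥2

OnlyLastIsOne-subdivide : ∀ j t → suc j < length t → OnlyLastIsOne t → OnlyLastIsOne (subdivideʳ j t)
OnlyLastIsOne-subdivide zero    (x ∷ y ∷ t) _        (x≥2 ∷ rest) = x≥2 ∷ ≤-trans x≥2 (m≤m+n x y) ∷ rest
OnlyLastIsOne-subdivide (suc j) (x ∷ t)     (s≤s lt) (x≥2 ∷ rest) = x≥2 ∷ OnlyLastIsOne-subdivide j t lt rest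
OnlyLastIsOne-subdivide zero    (x ∷ [])    (s≤s ()) _
OnlyLastIsOne-subdivide (suc j) (x ∷ [])    (s≤s ()) _

OnlyLastIsOne-smooth : ∀ j t → suc (suc j) < length t → OnlyLastIsOne t → OnlyLastIsOne (smoothʳ j t)
OnlyLastIsOne-smooth zero    (x ∷ m ∷ y ∷ t) _        (x≥2 ∷ _ ∷ rest) = x≥2 ∷ rest
OnlyLastIsOne-smooth (suc j) (x ∷ t)         (s≤s lt) (x≥2 ∷ rest)     = x≥2 ∷ OnlyLastIsOne-smooth j t lt rest
OnlyLastIsOne-smooth zero    (x ∷ [])        (s≤s ())       _
OnlyLastIsOne-smooth zero    (x ∷ m ∷ [])    (s≤s (s≤s ())) _
OnlyLastIsOne-smooth (suc j) (x ∷ [])        (s≤s ())       _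

RShape-subdivide : ∀ j rs → suc j < length rs → RShape rs → RShape (subdivideʳ j rs)
RShape-subdivide zero    (1 ∷ m ∷ t) _        (1∷ rest) = 1∷ (s≤s (OnlyLastIsOne-head-pos rest) ∷ rest)
RShape-subdivide (suc j) (1 ∷ t)     (s≤s lt) (1∷ rest) = 1∷ OnlyLastIsOne-subdivide j t lt rest
RShape-subdivide zero    (1 ∷ [])    (s≤s ()) _

RShape-smooth : ∀ j rs → suc (suc j) < length rs → RShape rs → RShape (smoothʳ j rs)
RShape-smooth zero    (1 ∷ m ∷ y ∷ t) _        (1∷ (_ ∷ rest)) = 1∷ rest
RShape-smooth (suc j) (1 ∷ t)         (s≤s lt) (1∷ rest)       = 1∷ OnlyLastIsOne-smooth j t lt rest
RShape-smooth zero    (1 ∷ [])        (s≤s ())       _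
RShape-smooth zero    (1 ∷ m ∷ [])    (s≤s (s≤s ())) _

record Structure (N : ℕ) (S : DR) : Set where
  constructor structure
  field
    length-d : length (proj₁ S) ≡ N
    kernel   : InKernel 0 (proj₁ S) (proj₂ S)
    r-shape  : RShape (proj₂ S)

Structure⇒d-pos : ∀ {N} S → Structure N S → All (0 <_) (proj₁ S)
Structure⇒d-pos (ds , .(1 ∷ _)) (structure _ k (1∷ rest)) =
  InKernel⇒d-pos ds _ k (z<s ∷ OnlyLastIsOne⇒pos rest) (OnlyLastIsOne-head-pos rest)

Structure-subdivide : ∀ {N} j S → Structure N S → suc j < N → Structure (suc N) (subdivide j S)
Structure-subdivide j (ds , rs) (structure refl k shape) lt = structure
  (length-subdivideᵈ j ds lt)
  (Equivalence.from (InKernel-subdivide 0 j ds rs lt) k)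
  (RShape-subdivide j rs (subst (suc j <_) (InKernel-length ds rs k) lt) shape)

subdivide-smooth : ∀ {l} j ds rs → InKernel l ds rs → All (0 <_) ds → getOr0 ds (suc j) ≡ 1 →
                   suc (suc j) < length ds → subdivide j (smooth j (ds , rs)) ≡ (ds , rs)
subdivide-smooth zero (suc a ∷ 1 ∷ suc b ∷ ds) (x ∷ m ∷ y ∷ rs) (_ , e , _) _ refl _ =
  cong (λ z → (suc a ∷ 1 ∷ suc b ∷ ds) , (x ∷ z ∷ y ∷ rs)) (sym (trans (sym (+-identityʳ m)) e))
subdivide-smooth (suc j) (a ∷ ds) (x ∷ rs) (_ , k) (_ ∷ pos) g (s≤s lt) =
  cong₂ _,_ (cong (a ∷_) (cong proj₁ ih)) (cong (x ∷_) (cong proj₂ ih))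
  where ih = subdivide-smooth j ds rs k pos g lt
subdivide-smooth zero (zero ∷ _ ∷ _ ∷ _)     _ _ (() ∷ _)         _ _
subdivide-smooth zero (suc _ ∷ _ ∷ zero ∷ _) _ _ (_ ∷ _ ∷ () ∷ _) _ _
subdivide-smooth zero (_ ∷ [])     _ _ _ _ (s≤s ())
subdivide-smooth zero (_ ∷ _ ∷ []) _ _ _ _ (s≤s (s≤s ()))
subdivide-smooth (suc j) (a ∷ ds) [] () _ _ _

Structure-smooth : ∀ {N} j S → Structure (suc N) S → getOr0 (proj₁ S) (suc j) ≡ 1 → suc j < N →
                   Structure N (smooth j S) × subdivide j (smooth j S) ≡ S
Structure-smooth j (ds , rs) v@(structure len k shape) d≡1 lt =
  structure length-smoothed kernel-smoothed (RShape-smooth j rs (subst (suc (suc j) <_) (InKernel-length ds rs k) lt′) shape)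
  , restored
  where
  lt′ : suc (suc j) < length ds
  lt′ = subst (suc (suc j) <_) (sym len) (s≤s lt)
  restored = subdivide-smooth j ds rs k (Structure⇒d-pos (ds , rs) v) d≡1 lt′
  length-smoothed : length (smoothᵈ j ds) ≡ _
  length-smoothed = suc-injective (trans (length-smoothᵈ j ds lt′) len)
  kernel-smoothed : InKernel 0 (smoothᵈ j ds) (smoothʳ j rs)
  kernel-smoothed = Equivalence.to (InKernel-subdivide 0 j (smoothᵈ j ds) (smoothʳ j rs) (subst (suc j <_) (sym length-smoothed) lt))
                                   (subst (λ S → InKernel 0 (proj₁ S) (proj₂ S)) (sym restored) k)

Structure-head≢1 : ∀ {N} S → Structure (3 + N) S → getOr0 (proj₁ S) 0 ≢ 1
Structure-head≢1 (.1 ∷ ds , _) (structure _ (e , _) (1∷ (x≥2 ∷ _))) refl = <⇒≢ x≥2 e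
Structure-head≢1 (d ∷ d₁ ∷ d₂ ∷ ds , _) (structure _ (_ , _ , ()) (1∷ [1]))

last-d≢1 : ∀ {l} ds t → InKernel l ds t → OnlyLastIsOne t → 2 ≤ l → ∀ i → suc i ≡ length ds → getOr0 ds i ≢ 1
last-d≢1 (.1 ∷ [])     _            (e , _) [1]         l≥2 zero    _  refl = <⇒≢ l≥2 (trans e (+-identityʳ _))
last-d≢1 (d ∷ d′ ∷ ds) (x ∷ t)      (_ , k) (x≥2 ∷ rest) _  (suc i) eq =
  last-d≢1 (d′ ∷ ds) t k rest x≥2 i (suc-injective eq)
last-d≢1 (d ∷ [])      (x ∷ y ∷ t)  (_ , ()) _ _ _ _
last-d≢1 (d ∷ d′ ∷ ds) (x ∷ [])     (_ , ()) _ _ _ _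

Structure-last≢1 : ∀ {N} S → Structure (3 + N) S → getOr0 (proj₁ S) (2 + N) ≢ 1
Structure-last≢1 (d ∷ d₁ ∷ ds , .(1 ∷ x ∷ t)) (structure len (_ , _ , k) (1∷ (_∷_ {x} {t} x≥2 rest))) =
  last-d≢1 ds t k rest x≥2 _ (sym (suc-injective (suc-injective len)))
Structure-last≢1 (d ∷ d₁ ∷ d₂ ∷ ds , _) (structure _ (_ , _ , ()) (1∷ [1]))

NoAdjacentOnes : List ℕ → Set
NoAdjacentOnes ds = ∀ i → getOr0 ds i ≡ 1 → getOr0 ds (suc i) ≡ 1 → ⊥

InKernel-no-adjacent-ones : ∀ {l} ds rs → InKernel l ds rs → 0 < l → All (0 <_) rs → NoAdjacentOnes ds
InKernel-no-adjacent-ones {l} (.1 ∷ .1 ∷ ds) (x ∷ y ∷ rs) (e₁ , e₂ , _) l>0 _ zero refl refl =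
  <⇒≢ (≤-trans l>0 (m≤m+n l h)) (+-cancelˡ-≡ y 0 (l + h) (begin
    y + 0     ≡⟨ e₂ ⟩
    x + h     ≡⟨ cong (_+ h) (trans (sym (+-identityʳ x)) e₁) ⟩
    l + y + h ≡⟨ swap l y h ⟩
    y + (l + h) ∎))
  where
  open ≡-Reasoning
  h = getOr0 rs 0
  swap : ∀ l y h → l + y + h ≡ y + (l + h)
  swap = solve-∀
InKernel-no-adjacent-ones (d ∷ ds) (x ∷ rs) (_ , k) _ (x>0 ∷ rs>0) (suc i) =
  InKernel-no-adjacent-ones ds rs k x>0 rs>0 i
InKernel-no-adjacent-ones (d ∷ []) (x ∷ []) _ _ _ zero _ ()

Structure-no-adjacent-ones : ∀ {N} S → Structure (3 + N) S → NoAdjacentOnes (proj₁ S)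
Structure-no-adjacent-ones S v zero d₀≡1 _ = Structure-head≢1 S v d₀≡1
Structure-no-adjacent-ones (d ∷ ds , .(1 ∷ _)) (structure _ (_ , k) (1∷ rest)) (suc i) =
  InKernel-no-adjacent-ones ds _ k z<s (OnlyLastIsOne⇒pos rest) i

-- With every d_i ≥ 2 the sequence r would be strictly increasing, so it could not end before a 0.
InKernel-without-one : ∀ {l} ds rs → InKernel l ds rs → All (2 ≤_) ds → l < getOr0 rs 0 → ⊥
InKernel-without-one {l} (d ∷ ds) (x ∷ rs) (e , k) (d≥2 ∷ ds≥2) l<x with getOr0 rs 0 ≤? x
... | no  h≰x = InKernel-without-one ds rs k ds≥2 (≰⇒> h≰x)
... | yes h≤x = <-irrefl refl (begin-strict
  x + x   ≡⟨ cong (x +_) (sym (+-identityʳ x)) ⟩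
  2 * x   ≤⟨ *-monoˡ-≤ x d≥2 ⟩
  d * x   ≡⟨ e ⟩
  l + h   ≤⟨ +-monoʳ-≤ l h≤x ⟩
  l + x   <⟨ +-monoˡ-< x l<x ⟩
  x + x   ∎)
  where
  open ≤-Reasoning
  h = getOr0 rs 0

∈⇒getOr0 : ∀ {x} xs → x ∈ xs → ∃[ i ] getOr0 xs i ≡ x × i < length xs
∈⇒getOr0 (y ∷ xs) (here refl) = 0 , refl , z<s
∈⇒getOr0 (y ∷ xs) (there x∈)  with ∈⇒getOr0 xs x∈
... | i , eq , lt = suc i , eq , s≤s lt

Structure-1∈d : ∀ {N} S → Structure N S → 1 ∈ proj₁ S
Structure-1∈d (ds , rs) v with 1 ∈? ds
... | yes 1∈ds = 1∈ds
... | no  1∉ds = ⊥-elim (InKernel-without-one ds rs (Structure.kernel v)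
                   (All.zipWith two≤ (Structure⇒d-pos (ds , rs) v , ¬Any⇒All¬ ds 1∉ds)) (head-pos v))
  where
  two≤ : ∀ {d} → 0 < d × ¬ 1 ≡ d → 2 ≤ d
  two≤ {suc zero}    (_ , d≢1) = ⊥-elim (d≢1 refl)
  two≤ {suc (suc d)} _         = s≤s (s≤s z≤n)
  head-pos : ∀ {N rs} → Structure N (ds , rs) → 0 < getOr0 rs 0
  head-pos (structure _ _ (1∷ _)) = z<s

Structure-interior-one : ∀ {N} S → Structure (3 + N) S → ∃[ j ] getOr0 (proj₁ S) (suc j) ≡ 1 × suc j < 2 + N
Structure-interior-one {N} S v with ∈⇒getOr0 (proj₁ S) (Structure-1∈d S v)
... | zero  , d≡1 , _  = ⊥-elim (Structure-head≢1 S v d≡1)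
... | suc j , d≡1 , lt with suc j ≟ 2 + N
...   | yes refl = ⊥-elim (Structure-last≢1 S v d≡1)
...   | no  j≢N  = j , d≡1 , ≤∧≢⇒< (≤-pred (subst (suc j <_) (Structure.length-d v) lt)) j≢N

base : DR
base = (1 ∷ 1 ∷ []) , (1 ∷ 1 ∷ [])

Structure-base : Structure 2 base
Structure-base = structure refl (refl , refl , _) (1∷ [1])

Structure-2⇒base : ∀ S → Structure 2 S → S ≡ base
Structure-2⇒base (a ∷ b ∷ [] , _) (structure refl (e₁ , e₂ , _) (1∷ [1])) =
  cong₂ (λ a b → (a ∷ b ∷ []) , (1 ∷ 1 ∷ [])) (trans (sym (*-identityʳ a)) e₁) (trans (sym (*-identityʳ b)) e₂)
Structure-2⇒base (a ∷ b ∷ [] , _) (structure refl (_ , _ , ()) (1∷ (_ ∷ (_ ∷ _))))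
Structure-2⇒base (a ∷ b ∷ [] , _) (structure refl (_ , _ , ()) (1∷ (_ ∷ [1])))

_≟DR_ : DecidableEquality DR
_≟DR_ = Productₚ.≡-dec (Listₚ.≡-dec _≟_) (Listₚ.≡-dec _≟_)

subdivisions : ℕ → DR → List DR
subdivisions N S = map (λ j → subdivide j S) (upTo N)

-- structures N lists the structures on P_(2+N).
structures : ℕ → List DR
structures zero    = base ∷ []
structures (suc N) = deduplicate _≟DR_ (concatMap (subdivisions (suc N)) (structures N))

record Enumeration (N : ℕ) (xs : List DR) : Set where
  field
    sound    : ∀ {S} → S ∈ xs → Structure N S
    complete : ∀ {S} → Structure N S → S ∈ xs
    unique   : Unique xs

structures-enumeration : ∀ N → Enumeration (2 + N) (structures N)
structures-enumeration zero = record
  { sound    = λ { (here refl) → Structure-base }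
  ; complete = λ {S} v → here (Structure-2⇒base S v)
  ; unique   = deduplicate-! _≟DR_ (base ∷ [])
  }
structures-enumeration (suc N) = record
  { sound    = sound
  ; complete = complete
  ; unique   = deduplicate-! _≟DR_ _
  }
  where
  open Enumeration (structures-enumeration N) renaming (sound to sound₀; complete to complete₀)
  sound : ∀ {S} → S ∈ structures (suc N) → Structure (3 + N) S
  sound S∈ with find (∈-concatMap⁻ (subdivisions (suc N)) (∈-deduplicate⁻ _≟DR_ _ S∈))
  ... | S₀ , S₀∈ , S∈subdivisions with ∈-map⁻ (λ j → subdivide j S₀) S∈subdivisions
  ...   | j , j∈ , refl = Structure-subdivide j S₀ (sound₀ S₀∈) (s≤s (∈-upTo⁻ j∈))
  complete : ∀ {S} → Structure (3 + N) S → S ∈ structures (suc N)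
  complete {S} v with Structure-interior-one S v
  ... | j , d≡1 , lt with Structure-smooth j S v d≡1 lt
  ...   | v₀ , restored = ∈-deduplicate⁺ _≟DR_ (∈-concatMap⁺ (subdivisions (suc N)) (lose (complete₀ v₀)
            (subst (_∈ subdivisions (suc N) (smooth j S)) restored (∈-map⁺ (λ i → subdivide i (smooth j S)) (∈-upTo⁺ (≤-pred lt))))))

subdivided-one : ∀ j ds → suc j < length ds → getOr0 (subdivideᵈ j ds) (suc j) ≡ 1
subdivided-one zero    (a ∷ b ∷ ds) _        = refl
subdivided-one (suc j) (a ∷ ds)     (s≤s lt) = subdivided-one j ds lt
subdivided-one zero    (a ∷ [])     (s≤s ())

ones′-subdivideᵈ+neighbours : ∀ j ds → All (0 <_) ds → suc j < length ds →
  ones′ (subdivideᵈ j ds) + isOne (getOr0 ds j) + isOne (getOr0 ds (suc j)) ≡ suc (ones′ ds)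
ones′-subdivideᵈ+neighbours zero (suc a ∷ suc b ∷ t) _ _ = begin
  suc (ones′ t) + isOne (suc a) + isOne (suc b)   ≡⟨ regroup (ones′ t) (isOne (suc a)) (isOne (suc b)) ⟩
  suc (isOne (suc a) + (isOne (suc b) + ones′ t)) ≡⟨ cong suc (sym (trans (ones′-∷ (suc a) _) (cong (isOne (suc a) +_) (ones′-∷ (suc b) t)))) ⟩
  suc (ones′ (suc a ∷ suc b ∷ t))                 ∎
  where
  open ≡-Reasoning
  regroup : ∀ o u v → suc o + u + v ≡ suc (u + (v + o))
  regroup = solve-∀
ones′-subdivideᵈ+neighbours (suc j) (a ∷ ds) (_ ∷ ds>0) (s≤s lt) = begin
  ones′ (a ∷ subdivideᵈ j ds) + u + v   ≡⟨ cong (λ o → o + u + v) (ones′-∷ a (subdivideᵈ j ds)) ⟩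
  isOne a + ones′ (subdivideᵈ j ds) + u + v ≡⟨ regroup (isOne a) (ones′ (subdivideᵈ j ds)) u v ⟩
  isOne a + (ones′ (subdivideᵈ j ds) + u + v) ≡⟨ cong (isOne a +_) (ones′-subdivideᵈ+neighbours j ds ds>0 lt) ⟩
  isOne a + suc (ones′ ds)               ≡⟨ +-suc (isOne a) (ones′ ds) ⟩
  suc (isOne a + ones′ ds)               ≡⟨ cong suc (sym (ones′-∷ a ds)) ⟩
  suc (ones′ (a ∷ ds))                   ∎
  where
  open ≡-Reasoning
  u = isOne (getOr0 ds j)
  v = isOne (getOr0 ds (suc j))
  regroup : ∀ w o u v → w + o + u + v ≡ w + (o + u + v)
  regroup = solve-∀
ones′-subdivideᵈ+neighbours zero (zero ∷ _ ∷ _)        (() ∷ _)     _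
ones′-subdivideᵈ+neighbours zero (suc _ ∷ zero ∷ _)    (_ ∷ () ∷ _) _
ones′-subdivideᵈ+neighbours zero (_ ∷ [])              _            (s≤s ())

Free : List ℕ → ℕ → Set
Free ds j = getOr0 ds j ≢ 1 × getOr0 ds (suc j) ≢ 1

free? : ∀ ds j → Dec (Free ds j)
free? ds j = ¬? (getOr0 ds j ≟ 1) ×-dec ¬? (getOr0 ds (suc j) ≟ 1)

ones′-subdivideᵈ≡⟦free⟧+ones′ : ∀ j ds → All (0 <_) ds → suc j < length ds → NoAdjacentOnes ds →
                  ones′ (subdivideᵈ j ds) ≡ ⟦ free? ds j ⟧ + ones′ ds
ones′-subdivideᵈ≡⟦free⟧+ones′ j ds ds>0 lt no-adjacent =
  by-cases (getOr0 ds j ≟ 1) (getOr0 ds (suc j) ≟ 1) (no-adjacent j) (ones′-subdivideᵈ+neighbours j ds ds>0 lt)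
  where
  by-cases : ∀ {A B : Set} {o o₀} (p : Dec A) (q : Dec B) → (A → ¬ B) →
             o + ⟦ p ⟧ + ⟦ q ⟧ ≡ suc o₀ → o ≡ ⟦ ¬? p ×-dec ¬? q ⟧ + o₀
  by-cases         (yes a) (yes b) a→¬b _ = contradiction b (a→¬b a)
  by-cases {o = o} (yes _) (no  _) _    e = suc-injective (trans (sym (o+1+0≡1+o o)) e)
    where
    o+1+0≡1+o : ∀ o → o + 1 + 0 ≡ suc o
    o+1+0≡1+o = solve-∀
  by-cases {o = o} (no  _) (yes _) _    e = suc-injective (trans (sym (o+0+1≡1+o o)) e)
    where
    o+0+1≡1+o : ∀ o → o + 0 + 1 ≡ suc o
    o+0+1≡1+o = solve-∀
  by-cases {o = o} (no  _) (no  _) _    e = trans (sym (trans (+-identityʳ (o + 0)) (+-identityʳ o))) e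

-- Each of the k ones of d blocks the two edges next to it, and these 2k edges are distinct.
free-count : ∀ a t → NoAdjacentOnes (a ∷ t) → getOr0 (a ∷ t) (length t) ≢ 1 →
  2 * ones′ (a ∷ t) + length (filter (free? (a ∷ t)) (upTo (length t))) ≡ length t + isOne a
free-count a []      _           last≢1 rewrite ones′-∷ a [] | isOne-≢1 last≢1 = refl
free-count a (b ∷ t) no-adjacent last≢1 = begin
  2 * ones′ (a ∷ b ∷ t) + length (filter (free? (a ∷ b ∷ t)) (upTo (suc (length t))))
    ≡⟨ cong₂ (λ o f → 2 * o + f) (ones′-∷ a (b ∷ t)) free-positions ⟩
  2 * (isOne a + ones′ (b ∷ t)) + (⟦ free? (a ∷ b ∷ t) 0 ⟧ + length (filter (free? (b ∷ t)) (upTo (length t))))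
    ≡⟨ step (a ≟ 1) (b ≟ 1) (no-adjacent 0) (free-count b t (no-adjacent ∘ suc) last≢1) ⟩
  suc (length t) + isOne a ∎
  where
  open ≡-Reasoning
  free-positions : length (filter (free? (a ∷ b ∷ t)) (upTo (suc (length t))))
                 ≡ ⟦ free? (a ∷ b ∷ t) 0 ⟧ + length (filter (free? (b ∷ t)) (upTo (length t)))
  free-positions = length-filter-upTo-suc (free? (a ∷ b ∷ t)) (length t)
  step : ∀ {o L n} (p : Dec (a ≡ 1)) (q : Dec (b ≡ 1)) → (a ≡ 1 → ¬ b ≡ 1) → 2 * o + L ≡ n + ⟦ q ⟧ →
         2 * (⟦ p ⟧ + o) + (⟦ ¬? p ×-dec ¬? q ⟧ + L) ≡ suc n + ⟦ p ⟧
  step         (yes a≡1) (yes b≡1) a→¬b _  = contradiction b≡1 (a→¬b a≡1)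
  step {o} {L} {n} (yes _) (no _) _ ih = trans (regroup o L) (trans (cong (2 +_) ih) (shift n))
    where
    regroup : ∀ o L → 2 * (1 + o) + (0 + L) ≡ 2 + (2 * o + L)
    regroup = solve-∀
    shift : ∀ n → 2 + (n + 0) ≡ suc n + 1
    shift = solve-∀
  step {n = n} (no _) (yes _) _ ih = trans ih (shift n)
    where
    shift : ∀ n → n + 1 ≡ suc n + 0
    shift = solve-∀
  step {o} {L} {n} (no _) (no _)  _ ih = trans (+-suc (2 * (0 + o)) L) (cong suc ih)

#indices-of-one : ∀ t → length (filter (λ j → getOr0 t j ≟ 1) (upTo (length t))) ≡ ones′ t
#indices-of-one []      = refl
#indices-of-one (x ∷ t) = begin
  length (filter (λ j → getOr0 (x ∷ t) j ≟ 1) (upTo (suc (length t))))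
    ≡⟨ length-filter-upTo-suc (λ j → getOr0 (x ∷ t) j ≟ 1) (length t) ⟩
  isOne x + length (filter (λ j → getOr0 t j ≟ 1) (upTo (length t)))
    ≡⟨ cong (isOne x +_) (#indices-of-one t) ⟩
  isOne x + ones′ t
    ≡⟨ sym (ones′-∷ x t) ⟩
  ones′ (x ∷ t) ∎
  where open ≡-Reasoning

#subdivisions-with-ones : ∀ {N} S → Structure (3 + N) S → ∀ m →
  length (filter (λ j → ones′ (subdivideᵈ j (proj₁ S)) ≟ suc m) (upTo (2 + N)))
    ≡ ⟦ ones′ (proj₁ S) ≟ m ⟧ * (2 + N ∸ 2 * m) + ⟦ ones′ (proj₁ S) ≟ suc m ⟧ * (2 * suc m)
#subdivisions-with-ones {N} (a ∷ t , rs) v m = begin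
  length (filter (λ j → ones′ (subdivideᵈ j ds) ≟ suc m) positions)
    ≡⟨ length-filter-≗-on _ _ (suc m) positions ones′-subdivided ⟩
  length (filter (λ j → ⟦ free? ds j ⟧ + o ≟ suc m) positions)
    ≡⟨ length-filter-⟦⟧+o≡1+m (free? ds) positions o m ⟩
  ⟦ o ≟ m ⟧ * F + ⟦ o ≟ suc m ⟧ * F̄
    ≡⟨ cong₂ _+_ (⟦⟧*-cong (o ≟ m) λ o≡m → subst (λ k → F ≡ 2 + N ∸ 2 * k) o≡m F≡)
                 (⟦⟧*-cong (o ≟ suc m) λ o≡1+m → subst (λ k → F̄ ≡ 2 * k) o≡1+m F̄≡) ⟩
  ⟦ o ≟ m ⟧ * (2 + N ∸ 2 * m) + ⟦ o ≟ suc m ⟧ * (2 * suc m) ∎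
  where
  open ≡-Reasoning
  ds = a ∷ t
  o = ones′ ds
  positions = upTo (2 + N)
  F = length (filter (free? ds) positions)
  F̄ = length (filter (¬? ∘ free? ds) positions)
  length-t : length t ≡ 2 + N
  length-t = suc-injective (Structure.length-d v)
  ones′-subdivided : ∀ {j} → j ∈ positions → ones′ (subdivideᵈ j ds) ≡ ⟦ free? ds j ⟧ + o
  ones′-subdivided {j} j∈ = ones′-subdivideᵈ≡⟦free⟧+ones′ j ds (Structure⇒d-pos (ds , rs) v)
    (subst (suc j <_) (sym (Structure.length-d v)) (s≤s (∈-upTo⁻ j∈))) (Structure-no-adjacent-ones (ds , rs) v)
  2o+F≡2+N : 2 * o + F ≡ 2 + N
  2o+F≡2+N = begin
    2 * o + F ≡⟨ subst (λ n → 2 * o + length (filter (free? ds) (upTo n)) ≡ n + isOne a) length-t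
                       (free-count a t (Structure-no-adjacent-ones (ds , rs) v)
                          (subst (λ i → getOr0 ds i ≢ 1) (sym length-t) (Structure-last≢1 (ds , rs) v))) ⟩
    2 + N + isOne a ≡⟨ cong (2 + N +_) (isOne-≢1 (Structure-head≢1 (ds , rs) v)) ⟩
    2 + N + 0 ≡⟨ +-identityʳ (2 + N) ⟩
    2 + N ∎
  F≡ : F ≡ 2 + N ∸ 2 * o
  F≡ = sym (trans (cong (_∸ 2 * o) (sym 2o+F≡2+N)) (m+n∸m≡n (2 * o) F))
  F̄≡ : F̄ ≡ 2 * o
  F̄≡ = +-cancelˡ-≡ F F̄ (2 * o) (begin
    F + F̄  ≡⟨ length-filter-+-complement (free? ds) positions ⟩
    length positions ≡⟨ length-upTo (2 + N) ⟩
    2 + N  ≡⟨ sym 2o+F≡2+N ⟩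
    2 * o + F ≡⟨ +-comm (2 * o) F ⟩
    F + 2 * o ∎)

withOnes : ℕ → List DR → List DR
withOnes k = filter (λ S → ones′ (proj₁ S) ≟ k)

-- count N k is the number of structures on P_(2+N) with d(1) = k.
count : ℕ → ℕ → ℕ
count N k = length (withOnes k (structures N))

count-zero : ∀ N → count N 0 ≡ 0
count-zero N = cong length (filter-none (λ S → ones′ (proj₁ S) ≟ 0) (All.tabulate λ {S} S∈ →
  >⇒≢ (filter-some (_≟ 1) (Any.map sym (Structure-1∈d S (Enumeration.sound (structures-enumeration N) S∈))))))

length-ones-after : ∀ {N} S → Structure (4 + N) S →
  length (filter (λ j → getOr0 (proj₁ S) (suc j) ≟ 1) (upTo (3 + N))) ≡ ones′ (proj₁ S)
length-ones-after {N} (a ∷ t , rs) v = begin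
  length (filter (λ j → getOr0 t j ≟ 1) (upTo (3 + N))) ≡⟨ cong (λ n → length (filter (λ j → getOr0 t j ≟ 1) (upTo n))) (sym length-t) ⟩
  length (filter (λ j → getOr0 t j ≟ 1) (upTo (length t))) ≡⟨ #indices-of-one t ⟩
  ones′ t ≡⟨ cong (_+ ones′ t) (sym (isOne-≢1 (Structure-head≢1 (a ∷ t , rs) v))) ⟩
  isOne a + ones′ t ≡⟨ sym (ones′-∷ a t) ⟩
  ones′ (a ∷ t) ∎
  where
  open ≡-Reasoning
  length-t = suc-injective (Structure.length-d v)

-- The pairs (S, j) with S on P_(3+N) and j an edge whose subdivision has k = suc m ones, against
-- the pairs (S′, j) with S′ on P_(4+N) with k ones and d′_(j+1) = 1.
module DoubleCounting (N m : ℕ) where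

  open ≡-Reasoning
  open Enumeration (structures-enumeration (1 + N)) renaming (sound to sound₀; complete to complete₀; unique to unique₀)
  open Enumeration (structures-enumeration (2 + N)) renaming (sound to sound₁; complete to complete₁; unique to unique₁)

  k : ℕ
  k = suc m

  raising : DR → List ℕ
  raising S = filter (λ j → ones′ (subdivideᵈ j (proj₁ S)) ≟ k) (upTo (2 + N))

  ones-after : DR → List ℕ
  ones-after S = filter (λ j → getOr0 (proj₁ S) (suc j) ≟ 1) (upTo (3 + N))

  P Q : List (DR × ℕ)
  P = pairsWith raising (structures (1 + N))
  Q = pairsWith ones-after (withOnes k (structures (2 + N)))

  subdivide′ smooth′ : DR × ℕ → DR × ℕ
  subdivide′ (S , j) = subdivide j S , j
  smooth′    (S , j) = smooth j S , j

  ∈P⇒ : ∀ {S j} → (S , j) ∈ P → Structure (3 + N) S × ones′ (subdivideᵈ j (proj₁ S)) ≡ k × suc j < 3 + N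
  ∈P⇒ {S} p with ∈-pairsWith⁻ raising _ p
  ... | S∈ , j∈ with ∈-filter⁻ (λ j → ones′ (subdivideᵈ j (proj₁ S)) ≟ k) {xs = upTo (2 + N)} j∈
  ...   | j∈upTo , ones≡k = sound₀ S∈ , ones≡k , s≤s (∈-upTo⁻ j∈upTo)

  ∈Q⇒ : ∀ {S j} → (S , j) ∈ Q →
        Structure (4 + N) S × ones′ (proj₁ S) ≡ k × getOr0 (proj₁ S) (suc j) ≡ 1 × suc j < 3 + N
  ∈Q⇒ {S} {j} q with ∈-pairsWith⁻ ones-after _ q
  ... | S∈′ , j∈ with ∈-filter⁻ (λ S → ones′ (proj₁ S) ≟ k) {xs = structures (2 + N)} S∈′
                    | ∈-filter⁻ (λ j → getOr0 (proj₁ S) (suc j) ≟ 1) {xs = upTo (3 + N)} j∈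
  ...   | S∈ , ones≡k | j∈upTo , d≡1 with suc j ≟ 3 + N
  ...     | yes refl = ⊥-elim (Structure-last≢1 S (sound₁ S∈) d≡1)
  ...     | no  j≢N  = sound₁ S∈ , ones≡k , d≡1 , ≤∧≢⇒< (∈-upTo⁻ j∈upTo) j≢N

  subdivide′∈Q : ∀ {x} → x ∈ P → subdivide′ x ∈ Q
  subdivide′∈Q {S , j} p with ∈P⇒ p
  ... | v , ones≡k , lt = ∈-pairsWith⁺ ones-after _
    (∈-filter⁺ (λ S → ones′ (proj₁ S) ≟ k) (complete₁ (Structure-subdivide j S v lt)) ones≡k)
    (∈-filter⁺ (λ i → getOr0 (subdivideᵈ j (proj₁ S)) (suc i) ≟ 1) (∈-upTo⁺ (<-trans (n<1+n j) lt))
               (subdivided-one j (proj₁ S) (subst (suc j <_) (sym (Structure.length-d v)) lt)))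

  smooth′∈P : ∀ {y} → y ∈ Q → smooth′ y ∈ P
  smooth′∈P {S , j} q with ∈Q⇒ q
  ... | v , ones≡k , d≡1 , lt with Structure-smooth j S v d≡1 lt
  ...   | v₀ , restored = ∈-pairsWith⁺ raising _ (complete₀ v₀)
    (∈-filter⁺ (λ i → ones′ (subdivideᵈ i (proj₁ (smooth j S))) ≟ k) (∈-upTo⁺ (≤-pred lt))
               (trans (cong (ones′ ∘ proj₁) restored) ones≡k))

  subdivide′-smooth′ : ∀ {y} → y ∈ Q → subdivide′ (smooth′ y) ≡ y
  subdivide′-smooth′ {S , j} q with ∈Q⇒ q
  ... | v , _ , d≡1 , lt = cong (_, j) (proj₂ (Structure-smooth j S v d≡1 lt))

  length-P≡length-Q : length P ≡ length Q
  length-P≡length-Q = length-≡-inverse-on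
    (Unique-pairsWith raising unique₀ λ S →
       Uniqueₚ.filter⁺ (λ j → ones′ (subdivideᵈ j (proj₁ S)) ≟ k) (Uniqueₚ.upTo⁺ (2 + N)))
    (Unique-pairsWith ones-after (Uniqueₚ.filter⁺ (λ S → ones′ (proj₁ S) ≟ k) unique₁) λ S →
       Uniqueₚ.filter⁺ (λ j → getOr0 (proj₁ S) (suc j) ≟ 1) (Uniqueₚ.upTo⁺ (3 + N)))
    subdivide′ smooth′ subdivide′∈Q smooth′∈P
    (λ { {S , j} _ → cong (_, j) (smooth-subdivide j S) }) subdivide′-smooth′

  length-Q : length Q ≡ k * count (2 + N) k
  length-Q = trans (length-pairsWith ones-after (withOnes k (structures (2 + N))))
    (sum-map-const-on (length ∘ ones-after) k (withOnes k (structures (2 + N))) λ {S} S∈′ →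
      let S∈ , ones≡k = ∈-filter⁻ (λ S → ones′ (proj₁ S) ≟ k) {xs = structures (2 + N)} S∈′
      in trans (length-ones-after S (sound₁ S∈)) ones≡k)

  length-P : length P ≡ (2 + N ∸ 2 * m) * count (1 + N) m + 2 * k * count (1 + N) k
  length-P = begin
    length P
      ≡⟨ length-pairsWith raising (structures (1 + N)) ⟩
    sum (map (length ∘ raising) (structures (1 + N)))
      ≡⟨ sum-map-cong-on (length ∘ raising) _ (structures (1 + N)) (λ {S} S∈ → #subdivisions-with-ones S (sound₀ S∈) m) ⟩
    sum (map (λ S → ⟦ ones′ (proj₁ S) ≟ m ⟧ * (2 + N ∸ 2 * m) + ⟦ ones′ (proj₁ S) ≟ k ⟧ * (2 * k)) (structures (1 + N)))
      ≡⟨ sum-map-⟦⟧*+⟦⟧* (λ S → ones′ (proj₁ S) ≟ m) (λ S → ones′ (proj₁ S) ≟ k) (2 + N ∸ 2 * m) (2 * k) (structures (1 + N)) ⟩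
    (2 + N ∸ 2 * m) * count (1 + N) m + 2 * k * count (1 + N) k ∎

count-recurrence : ∀ N m →
  suc m * count (2 + N) (suc m) ≡ (2 + N ∸ 2 * m) * count (1 + N) m + 2 * suc m * count (1 + N) (suc m)
count-recurrence N m = begin
  suc m * count (2 + N) (suc m) ≡⟨ sym length-Q ⟩
  length Q                      ≡⟨ sym length-P≡length-Q ⟩
  length P                      ≡⟨ length-P ⟩
  (2 + N ∸ 2 * m) * count (1 + N) m + 2 * suc m * count (1 + N) (suc m) ∎
  where
  open ≡-Reasoning
  open DoubleCounting N m using (P; Q; length-P; length-Q; length-P≡length-Q)

count≡closedForm : ∀ n k → count (1 + n) k ≡ closedForm n k
count≡closedForm zero    zero          = refl
count≡closedForm zero    (suc zero)    = refl
count≡closedForm zero    (suc (suc _)) = refl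
count≡closedForm (suc n) zero          = count-zero (2 + n)
count≡closedForm (suc n) (suc m)       = *-cancelˡ-≡ _ _ (suc m) (begin
  suc m * count (2 + n) (suc m)
    ≡⟨ count-recurrence n m ⟩
  (2 + n ∸ 2 * m) * count (1 + n) m + 2 * suc m * count (1 + n) (suc m)
    ≡⟨ cong₂ (λ a b → (2 + n ∸ 2 * m) * a + 2 * suc m * b) (count≡closedForm n m) (count≡closedForm n (suc m)) ⟩
  (2 + n ∸ 2 * m) * closedForm n m + 2 * suc m * closedForm n (suc m)
    ≡⟨ sym (closedForm-recurrence n m) ⟩
  suc m * closedForm (suc n) (suc m) ∎)
  where open ≡-Reasoning

IndexedKernel : ℕ → List ℕ → List ℕ → Set
IndexedKernel l ds rs = ∀ i → i < length ds → getOr0 ds i * getOr0 rs i ≡ getOr0 (l ∷ rs) i + getOr0 rs (suc i)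

InKernel⇒IndexedKernel : ∀ {l} ds rs → InKernel l ds rs → IndexedKernel l ds rs
InKernel⇒IndexedKernel (d ∷ ds) (x ∷ xs) (e , _) zero    _        = e
InKernel⇒IndexedKernel (d ∷ ds) (x ∷ xs) (_ , k) (suc i) (s≤s lt) = InKernel⇒IndexedKernel ds xs k i lt

IndexedKernel⇒InKernel : ∀ {l} ds rs → length ds ≡ length rs → IndexedKernel l ds rs → InKernel l ds rs
IndexedKernel⇒InKernel []       []       _   _ = _
IndexedKernel⇒InKernel (d ∷ ds) (x ∷ xs) len h =
  h 0 z<s , IndexedKernel⇒InKernel ds xs (suc-injective len) (λ i lt → h (suc i) (s≤s lt))

lookup≡getOr0 : ∀ {N} (v : Vec ℕ N) j → lookup v j ≡ getOr0 (toList v) (toℕ j)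
lookup≡getOr0 (x ∷ᵥ v) Fin.zero    = refl
lookup≡getOr0 (x ∷ᵥ v) (Fin.suc j) = lookup≡getOr0 v j

leftNbr≡getOr0 : ∀ {N} (r : Vec ℕ N) i → leftNbr r i ≡ getOr0 (0 ∷ toList r) i
leftNbr≡getOr0 r zero    = refl
leftNbr≡getOr0 r (suc i) = refl

PathEq⇔InKernel : ∀ {N} (d r : Vec ℕ N) → PathEq d r ⇔ InKernel 0 (toList d) (toList r)
PathEq⇔InKernel {N} d r = mk⇔
  (λ eq → IndexedKernel⇒InKernel _ _ (trans (length-toList d) (sym (length-toList r))) (indexed eq))
  (λ k j → trans (cong₂ _*_ (lookup≡getOr0 d j) (lookup≡getOr0 r j))
    (trans (InKernel⇒IndexedKernel _ _ k (toℕ j) (subst (toℕ j <_) (sym (length-toList d)) (toℕ<n j)))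
           (cong (_+ rightNbr r (toℕ j)) (sym (leftNbr≡getOr0 r (toℕ j))))))
  where
  indexed : PathEq d r → IndexedKernel 0 (toList d) (toList r)
  indexed eq i lt = subst (λ i → getOr0 (toList d) i * getOr0 (toList r) i ≡ getOr0 (0 ∷ toList r) i + getOr0 (toList r) (suc i))
    (toℕ-fromℕ< i<N)
    (trans (sym (cong₂ _*_ (lookup≡getOr0 d j) (lookup≡getOr0 r j)))
           (trans (eq j) (cong (_+ rightNbr r (toℕ j)) (leftNbr≡getOr0 r (toℕ j)))))
    where
    i<N = subst (i <_) (length-toList d) lt
    j = fromℕ< i<N

InKernel-head-divides : ∀ {c l} ds rs → InKernel l ds rs → c ∣ l → c ∣ getOr0 rs 0 → All (c ∣_) rs
InKernel-head-divides []       []       _       _   _   = []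
InKernel-head-divides {c} (d ∷ ds) (x ∷ xs) (e , k) c∣l c∣x =
  c∣x ∷ InKernel-head-divides ds xs k c∣x (∣m+n∣m⇒∣n (subst (c ∣_) e (∣n⇒∣m*n d c∣x)) c∣l)

lastEntry : List ℕ → ℕ
lastEntry []          = 0
lastEntry (x ∷ [])    = x
lastEntry (x ∷ y ∷ t) = lastEntry (y ∷ t)

InKernel-last-divides : ∀ {l} ds rs → InKernel l ds rs → 0 < length rs → lastEntry rs ∣ l × All (lastEntry rs ∣_) rs
InKernel-last-divides (d ∷ [])      (x ∷ [])     (e , _) _ =
  subst (x ∣_) (trans e (+-identityʳ _)) (∣n⇒∣m*n d ∣-refl) , ∣-refl ∷ []
InKernel-last-divides (d ∷ d′ ∷ ds) (x ∷ y ∷ ys) (e , k) _ with InKernel-last-divides (d′ ∷ ds) (y ∷ ys) k z<s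
... | c∣x , c∣rs = ∣m+n∣m⇒∣n (subst (lastEntry (y ∷ ys) ∣_) (trans e (+-comm _ y)) (∣n⇒∣m*n d c∣x)) (All.head c∣rs) , c∣x ∷ c∣rs
InKernel-last-divides (d ∷ [])      (x ∷ y ∷ ys) (_ , ()) _
InKernel-last-divides (d ∷ d′ ∷ ds) (x ∷ [])     (_ , ()) _

∣-gcdAll : ∀ {c} xs → All (c ∣_) xs → c ∣ foldr gcd 0 xs
∣-gcdAll []       []          = _ ∣0
∣-gcdAll (x ∷ xs) (c∣x ∷ c∣xs) = gcd-greatest c∣x (∣-gcdAll xs c∣xs)

OnlyLastIsOne⇒ones′≡1 : ∀ {t} → OnlyLastIsOne t → ones′ t ≡ 1
OnlyLastIsOne⇒ones′≡1 [1]                        = refl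
OnlyLastIsOne⇒ones′≡1 (_∷_ {x} {t} x≥2 rest) =
  trans (ones′-∷ x t) (cong₂ _+_ (isOne-≢1 (>⇒≢ x≥2)) (OnlyLastIsOne⇒ones′≡1 rest))

lastEntry≡1⇒ones′-pos : ∀ t → 0 < length t → lastEntry t ≡ 1 → 0 < ones′ t
lastEntry≡1⇒ones′-pos (x ∷ [])    _ refl = z<s
lastEntry≡1⇒ones′-pos (x ∷ y ∷ t) _ last≡1 = subst (0 <_) (sym (ones′-∷ x (y ∷ t)))
  (≤-trans (lastEntry≡1⇒ones′-pos (y ∷ t) z<s last≡1) (m≤n+m _ (isOne x)))

OnlyLastIsOne-intro : ∀ t → 0 < length t → All (0 <_) t → lastEntry t ≡ 1 → ones′ t ≡ 1 → OnlyLastIsOne t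
OnlyLastIsOne-intro (x ∷ [])    _ _           refl _ = [1]
OnlyLastIsOne-intro (x ∷ y ∷ t) _ (x>0 ∷ t>0) last≡1 ones≡1 with x ≟ 1
... | yes refl = contradiction (suc-injective (trans (sym (ones′-∷ 1 (y ∷ t))) ones≡1))
                               (>⇒≢ (lastEntry≡1⇒ones′-pos (y ∷ t) z<s last≡1))
... | no  x≢1  = two≤ x>0 x≢1 ∷ OnlyLastIsOne-intro (y ∷ t) z<s t>0 last≡1
                   (trans (sym (cong (_+ ones′ (y ∷ t)) (isOne-≢1 x≢1))) (trans (sym (ones′-∷ x (y ∷ t))) ones≡1))
  where
  two≤ : ∀ {x} → 0 < x → x ≢ 1 → 2 ≤ x
  two≤ {suc zero}    _ x≢1 = contradiction refl x≢1
  two≤ {suc (suc x)} _ _   = s≤s (s≤s z≤n)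

-- r₁ and r_N divide every entry of r, hence the gcd, so primitivity forces both to be 1.
RShape-intro : ∀ ds rs → InKernel 0 ds rs → 2 ≤ length rs → All (0 <_) rs → foldr gcd 0 rs ≡ 1 → ones′ rs ≡ 2 → RShape rs
RShape-intro ds (x ∷ y ∷ t) k _ (_ ∷ t>0) gcd≡1 ones≡2 with ∣1⇒≡1 (subst (x ∣_) gcd≡1 (∣-gcdAll _ (InKernel-head-divides ds _ k (x ∣0) ∣-refl)))
... | refl = 1∷ OnlyLastIsOne-intro (y ∷ t) z<s t>0
  (∣1⇒≡1 (subst (lastEntry (y ∷ t) ∣_) gcd≡1 (∣-gcdAll _ (proj₂ (InKernel-last-divides ds _ k z<s)))))
  (suc-injective (trans (sym (ones′-∷ 1 (y ∷ t))) ones≡2))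
RShape-intro ds (x ∷ []) _ (s≤s ()) _ _ _

RShape⇒pos : ∀ {rs} → RShape rs → All (0 <_) rs
RShape⇒pos (1∷ rest) = z<s ∷ OnlyLastIsOne⇒pos rest

RShape⇒gcd≡1 : ∀ {rs} → RShape rs → foldr gcd 0 rs ≡ 1
RShape⇒gcd≡1 (1∷_ {t} _) = gcd-zeroˡ (foldr gcd 0 t)

RShape⇒ones′≡2 : ∀ {rs} → RShape rs → ones′ rs ≡ 2
RShape⇒ones′≡2 (1∷ rest) = cong suc (OnlyLastIsOne⇒ones′≡1 rest)

Structure⇔IsArithStructure : ∀ {N} (d r : Vec ℕ N) → 2 ≤ N →
  Structure N (toList d , toList r) ⇔ (IsArithStructure d r × ones r ≡ 2)
Structure⇔IsArithStructure d r 2≤N = mk⇔ to from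
  where
  to : Structure _ (toList d , toList r) → IsArithStructure d r × ones r ≡ 2
  to v@(structure _ k shape) =
    record { d-pos       = Structure⇒d-pos _ v
           ; r-pos       = RShape⇒pos shape
           ; r-primitive = RShape⇒gcd≡1 shape
           ; kernel      = Equivalence.from (PathEq⇔InKernel d r) k }
    , RShape⇒ones′≡2 shape
  from : IsArithStructure d r × ones r ≡ 2 → Structure _ (toList d , toList r)
  from (a , ones≡2) = structure (length-toList d) k
    (RShape-intro _ _ k (subst (2 ≤_) (sym (length-toList r)) 2≤N) (IsArithStructure.r-pos a) (IsArithStructure.r-primitive a) ones≡2)
    where k = Equivalence.to (PathEq⇔InKernel d r) (IsArithStructure.kernel a)

toVec : ∀ N → List ℕ → Vec ℕ N
toVec zero    _        = []ᵥ
toVec (suc N) []       = 0 ∷ᵥ toVec N []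
toVec (suc N) (x ∷ xs) = x ∷ᵥ toVec N xs

toList-toVec : ∀ N xs → length xs ≡ N → toList (toVec N xs) ≡ xs
toList-toVec zero    []       _   = refl
toList-toVec (suc N) (x ∷ xs) len = cong (x ∷_) (toList-toVec N xs (suc-injective len))

toVec-toList : ∀ {N} (v : Vec ℕ N) → toVec N (toList v) ≡ v
toVec-toList []ᵥ       = refl
toVec-toList (x ∷ᵥ v) = cong (x ∷ᵥ_) (toVec-toList v)

vectors : ∀ N → List DR → List (Vec ℕ N × Vec ℕ N)
vectors N = map (λ S → toVec N (proj₁ S) , toVec N (proj₂ S))

Enumeration⇒vectors : ∀ {N xs} → 2 ≤ N → Enumeration N xs → ∀ k →
  Unique (vectors N (withOnes k xs)) ×
  ((d r : Vec ℕ N) → ((d , r) ∈ vectors N (withOnes k xs)) ⇔ (IsArithStructure d r × ones r ≡ 2 × ones d ≡ k))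
Enumeration⇒vectors {N} {xs} 2≤N E k = Unique-map-on _ (Uniqueₚ.filter⁺ _ unique) injective , λ d r → mk⇔ (to d r) (from d r)
  where
  open Enumeration E
  ones≟k = λ (S : DR) → ones′ (proj₁ S) ≟ k
  toLists-toVecs : ∀ {S} → S ∈ withOnes k xs → (toList (toVec N (proj₁ S)) , toList (toVec N (proj₂ S))) ≡ S
  toLists-toVecs {ds , rs} S∈ = cong₂ _,_ (toList-toVec N ds length-d)
                                          (toList-toVec N rs (trans (sym (InKernel-length ds rs kernel)) length-d))
    where open Structure (sound (proj₁ (∈-filter⁻ ones≟k {xs = xs} S∈)))
  injective : ∀ {S S′} → S ∈ withOnes k xs → S′ ∈ withOnes k xs →
              (toVec N (proj₁ S) , toVec N (proj₂ S)) ≡ (toVec N (proj₁ S′) , toVec N (proj₂ S′)) → S ≡ S′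
  injective S∈ S′∈ eq = trans (sym (toLists-toVecs S∈))
    (trans (cong (λ (d , r) → toList d , toList r) eq) (toLists-toVecs S′∈))
  to : ∀ d r → (d , r) ∈ vectors N (withOnes k xs) → IsArithStructure d r × ones r ≡ 2 × ones d ≡ k
  to d r dr∈ with ∈-map⁻ _ dr∈
  ... | S , S∈ , refl = a , ones-r , trans (cong (ones′ ∘ proj₁) (toLists-toVecs S∈)) (proj₂ (∈-filter⁻ ones≟k {xs = xs} S∈))
    where
    v = subst (Structure N) (sym (toLists-toVecs S∈)) (sound (proj₁ (∈-filter⁻ ones≟k {xs = xs} S∈)))
    a = proj₁ (Equivalence.to (Structure⇔IsArithStructure _ _ 2≤N) v)
    ones-r = proj₂ (Equivalence.to (Structure⇔IsArithStructure _ _ 2≤N) v)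
  from : ∀ d r → IsArithStructure d r × ones r ≡ 2 × ones d ≡ k → (d , r) ∈ vectors N (withOnes k xs)
  from d r (a , ones-r , ones-d) = subst (_∈ vectors N (withOnes k xs)) (cong₂ _,_ (toVec-toList d) (toVec-toList r))
    (∈-map⁺ _ (∈-filter⁺ ones≟k (complete (Equivalence.from (Structure⇔IsArithStructure d r 2≤N) (a , ones-r))) ones-d))

closedForm≡formula : ∀ n m → closedForm n (suc m)
  ≡ ((suc n ∸ 1) C (2 * suc m ∸ 2)) * (2 ^ (suc n + 1 ∸ 2 * suc m)) * catalan (suc m ∸ 1)
closedForm≡formula n m = cong₂ (λ c e → c * 2 ^ e * catalan m)
  (trans (choose≡C n (2 * m)) (cong (λ a → n C (a ∸ 2)) (sym (2*[1+m]≡2+2*m m))))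
  (cong₂ _∸_ (+-comm 1 (suc n)) (sym (2*[1+m]≡2+2*m m)))

proposition2p22 : (n k : ℕ) → 1 ≤ n → 1 ≤ k →
    Σ (List (Vec ℕ (n + 2) × Vec ℕ (n + 2))) (λ L →
      Unique L ×
      ((d r : Vec ℕ (n + 2)) →
        ((d , r) ∈ L) ⇔ (IsArithStructure d r × ones r ≡ 2 × ones d ≡ k)) ×
      length L ≡ ((n ∸ 1) C (2 * k ∸ 2)) * (2 ^ (n + 1 ∸ 2 * k)) * catalan (k ∸ 1))
proposition2p22 (suc n) (suc m) _ _ = vectors (suc n + 2) Sₖ , unique , members , (begin
    length (vectors (suc n + 2) Sₖ) ≡⟨ length-map _ Sₖ ⟩
    count (suc n) (suc m)           ≡⟨ count≡closedForm n (suc m) ⟩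
    closedForm n (suc m)            ≡⟨ closedForm≡formula n m ⟩
    _                               ∎)
  where
  open ≡-Reasoning
  Sₖ = withOnes (suc m) (structures (suc n))
  E = subst (λ N → Enumeration N (structures (suc n))) (+-comm 2 (suc n)) (structures-enumeration (suc n))
  2≤N = subst (2 ≤_) (+-comm 2 (suc n)) (s≤s (s≤s z≤n))
  unique = proj₁ (Enumeration⇒vectors 2≤N E (suc m))
  members = proj₂ (Enumeration⇒vectors 2≤N E (suc m))
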